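{- Let $t\ge1$, $0\le k\le\lfloor t/2\rfloor$, and let $v$ be a $k$-vector. For an integer $s$ with $0\le s\le\lfloor t/2\rfloor$, there exists an $s$-vector orthogonal to $v$ if and only if $s\in[\lceil t/2\rceil-k,\ \lfloor t/2\rfloor]$.
   Context: Fix $t\ge1$. A $(0,1)$-vector of length $4t$ is divided into four quarters: positions $1..t$, $t+1..2t$, $2t+1..3t$, $3t+1..4t$. For $0\le k\le t$, a $k$-vector is a $(0,1)$-vector of length $4t$ with exactly $k$, $t-k$, $t-k$, $k$ ones in the four quarters respectively. Two $(0,1)$-vectors are orthogonal if their images under $0\mapsto1$, $1\mapsto-1$ are orthogonal (standard inner product). -}

module Defs where

open import Data.Bool using (Bool; true; false)
open import Data.Nat using (ℕ; zero; suc; _+_; _*_; _∸_; _/_)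
open import Data.Integer using (ℤ; +_; -_) renaming (_+_ to _+ℤ_; _*_ to _*ℤ_)
open import Data.Vec using (Vec; []; _∷_; take; drop; count; zipWith; foldr)
open import Data.Bool.Properties using (T?)
open import Relation.Binary.PropositionalEquality using (_≡_)

-- length 4t, written so that the quarters are literal prefixes/suffixes
Len : ℕ → ℕ
Len t = t + (t + (t + t))

q1 q2 q3 q4 : (t : ℕ) → Vec Bool (Len t) → Vec Bool t
q1 t v = take t v
q2 t v = take t (drop t v)
q3 t v = take t (drop t (drop t v))
q4 t v = drop t (drop t (drop t v))

-- number of ones in a (0,1)-vector (true = 1)
ones : ∀ {n} → Vec Bool n → ℕ
ones = count T?

IsKVec : (t k : ℕ) → Vec Bool (Len t) → Set
IsKVec t k v =
  (ones (q1 t v) ≡ k) Data.Product.× (ones (q2 t v) ≡ t ∸ k)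
    Data.Product.× (ones (q3 t v) ≡ t ∸ k) Data.Product.× (ones (q4 t v) ≡ k)
  where import Data.Product

sgn : Bool → ℤ
sgn false = + 1
sgn true  = - (+ 1)

inner : ∀ {n} → Vec Bool n → Vec Bool n → ℤ
inner u w = foldr _ _+ℤ_ (+ 0) (zipWith (λ a b → sgn a *ℤ sgn b) u w)

Orthogonal : ∀ {n} → Vec Bool n → Vec Bool n → Set
Orthogonal u w = inner u w ≡ + 0

⌈_/2⌉ : ℕ → ℕ
⌈ t /2⌉ = (t + 1) / 2

module Submission where

-- For vectors of length n the
-- ±1 inner product equals n − 2d, where d is the Hamming distance, so v ⊥ w iff
-- 2·d(v,w) = 4t.  The distance splits over the four quarters.  In an outer quarter
-- v and w carry k and s ones; if p of these positions are shared, the quarter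
-- contributes k + s − 2p ≤ k + s.  An inner quarter carries k and s zeros, and the
-- same holds after complementing both vectors.  Writing c = k + s:
--   (⇒) 4t = 2·d(v,w) ≤ 8c, i.e. t ≤ 2c, which is ⌈t/2⌉ − k ≤ s;
--   (⇐) if t ≤ 2c, the total overlap P = 2c − t lies in [0, 4·min(k,s)] because
--       2k, 2s ≤ t; splitting P into four overlaps p_i ≤ min(k,s) and realizing
--       each quarter with overlap p_i yields an s-vector w with d(v,w) = 4c − 2P = 2t.

open import Defs
open import Data.Bool using (Bool; true; false; not; _xor_)
open import Data.Bool.Properties using (T?; not-involutive; xor-annihilates-not)
open import Data.Nat using (ℕ; zero; suc; _+_; _*_; _∸_; _/_; _%_; _⊓_; _≤_; z≤n; s≤s; s≤s⁻¹)
open import Data.Nat.Properties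
open import Data.Nat.DivMod using (m/n*n≤m; m<n*o⇒m/o<n; m≡m%n+[m/n]*n; m%n<n)
open import Data.Nat.Tactic.RingSolver using (solve-∀)
open import Data.Integer using (-[1+_]; _⊖_) renaming (_+_ to _+ℤ_)
import Data.Integer as ℤ
import Data.Integer.Properties as ℤP
open import Data.Vec using (Vec; []; _∷_; _++_; take; drop; map; zipWith)
open import Data.Vec.Properties using (take++drop≡id; ++-injective; zipWith-++; count≤n)
open import Data.Product using (Σ; _×_; _,_)
open import Function.Bundles using (_⇔_; mk⇔; Equivalence)
open import Relation.Binary.PropositionalEquality

Len≡4* : ∀ n → Len n ≡ 4 * n
Len≡4* n = four-fold n
  where
    four-fold : ∀ m → m + (m + (m + m)) ≡ 4 * m
    four-fold = solve-∀

hamming : ∀ {n} → Vec Bool n → Vec Bool n → ℕ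
hamming x y = ones (zipWith _xor_ x y)

ones-++ : ∀ {m n} (x : Vec Bool m) (y : Vec Bool n) → ones (x ++ y) ≡ ones x + ones y
ones-++ []          y = refl
ones-++ (true ∷ x)  y = cong suc (ones-++ x y)
ones-++ (false ∷ x) y = ones-++ x y

hamming-++ : ∀ {m n} (x : Vec Bool m) (x′ : Vec Bool n) (y : Vec Bool m) (y′ : Vec Bool n) →
  hamming (x ++ x′) (y ++ y′) ≡ hamming x y + hamming x′ y′
hamming-++ x x′ y y′ =
  trans (cong ones (zipWith-++ _xor_ x x′ y y′)) (ones-++ (zipWith _xor_ x y) (zipWith _xor_ x′ y′))

-- An agreeing position adds 1 to the inner product and a disagreeing one
-- subtracts 1; in terms of n ⊖ 2d these are the two steps below.
⊖-agree : ∀ {i} n d → i ≡ n ⊖ d → ℤ.+ 1 +ℤ i ≡ suc n ⊖ d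
⊖-agree n d e = trans (cong (ℤ.+ 1 +ℤ_) e) (ℤP.distribʳ-⊖-+-pos 1 n d)

⊖-disagree : ∀ {i} n d → i ≡ n ⊖ 2 * d → -[1+ 0 ] +ℤ i ≡ suc n ⊖ 2 * suc d
⊖-disagree {i} n d e = begin
  -[1+ 0 ] +ℤ i           ≡⟨ cong (-[1+ 0 ] +ℤ_) e ⟩
  -[1+ 0 ] +ℤ (n ⊖ 2 * d) ≡⟨ ℤP.distribʳ-⊖-+-neg 0 n (2 * d) ⟩
  n ⊖ suc (2 * d)         ≡⟨ ℤP.[1+m]⊖[1+n]≡m⊖n n (suc (2 * d)) ⟨
  suc n ⊖ (2 + 2 * d)     ≡⟨ cong (suc n ⊖_) (*-suc 2 d) ⟨
  suc n ⊖ 2 * suc d       ∎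
  where open ≡-Reasoning

inner-hamming : ∀ {n} (x y : Vec Bool n) → inner x y ≡ n ⊖ 2 * hamming x y
inner-hamming [] [] = refl
inner-hamming {suc n} (true ∷ x)  (true ∷ y)  = ⊖-agree n (2 * hamming x y) (inner-hamming x y)
inner-hamming {suc n} (false ∷ x) (false ∷ y) = ⊖-agree n (2 * hamming x y) (inner-hamming x y)
inner-hamming {suc n} (true ∷ x)  (false ∷ y) = ⊖-disagree n (hamming x y) (inner-hamming x y)
inner-hamming {suc n} (false ∷ x) (true ∷ y)  = ⊖-disagree n (hamming x y) (inner-hamming x y)

orthogonal⇔ : ∀ {n} (x y : Vec Bool n) → Orthogonal x y ⇔ (2 * hamming x y ≡ n)
orthogonal⇔ {n} x y = mk⇔ to from
  where
    to : Orthogonal x y → 2 * hamming x y ≡ n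
    to orth = sym (ℤP.+-injective (ℤP.i-j≡0⇒i≡j (ℤ.+ n) (ℤ.+ (2 * hamming x y))
      (trans (ℤP.m-n≡m⊖n n (2 * hamming x y)) (trans (sym (inner-hamming x y)) orth))))
    from : 2 * hamming x y ≡ n → Orthogonal x y
    from e = trans (inner-hamming x y) (trans (cong (n ⊖_) e) (ℤP.n⊖n≡0 n))

-- A position where x and y differ carries a one in x or in y.
hamming≤ones : ∀ {n} (x y : Vec Bool n) → hamming x y ≤ ones x + ones y
hamming≤ones [] [] = z≤n
hamming≤ones (true ∷ x)  (true ∷ y)  =
  ≤-trans (hamming≤ones x y) (+-mono-≤ (n≤1+n (ones x)) (n≤1+n (ones y)))
hamming≤ones (false ∷ x) (false ∷ y) = hamming≤ones x y
hamming≤ones (true ∷ x)  (false ∷ y) = s≤s (hamming≤ones x y)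
hamming≤ones (false ∷ x) (true ∷ y)  =
  subst (suc (hamming x y) ≤_) (sym (+-suc (ones x) (ones y))) (s≤s (hamming≤ones x y))

complement : ∀ {n} → Vec Bool n → Vec Bool n
complement = map not

-- Given p of the ones and q of the zeros of x, the vector y having its ones
-- exactly there has p + q ones and differs from x in (ones x − p) + q positions.
realize : ∀ {n} (x : Vec Bool n) {p q} → p ≤ ones x → q ≤ ones (complement x) →
  Σ (Vec Bool n) λ y → ones y ≡ p + q × hamming x y + p ≡ ones x + q
realize [] {zero} {zero} z≤n z≤n = [] , refl , refl
realize (true ∷ x) {suc p} (s≤s hp) hq with realize x hp hq
... | y , ones-y , dist = true ∷ y , cong suc ones-y , trans (+-suc _ p) (cong suc dist)
realize (true ∷ x) {zero} _ hq with realize x z≤n hq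
... | y , ones-y , dist = false ∷ y , ones-y , cong suc dist
realize (false ∷ x) {p} {suc q} hp (s≤s hq) with realize x hp hq
... | y , ones-y , dist =
  true ∷ y , trans (cong suc ones-y) (sym (+-suc p q)) , trans (cong suc dist) (sym (+-suc _ q))
realize (false ∷ x) {p} {zero} hp _ with realize x hp z≤n
... | y , ones-y , dist = false ∷ y , ones-y , dist

ones-complement : ∀ {n} (x : Vec Bool n) → ones (complement x) ≡ n ∸ ones x
ones-complement []          = refl
ones-complement (true ∷ x)  = ones-complement x
ones-complement {suc n} (false ∷ x) =
  trans (cong suc (ones-complement x)) (sym (+-∸-assoc 1 (count≤n T? x)))

hamming-complement : ∀ {n} (x y : Vec Bool n) → hamming (complement x) (complement y) ≡ hamming x y
hamming-complement x y = cong ones (xor-complement x y)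
  where
    xor-complement : ∀ {n} (x y : Vec Bool n) →
      zipWith _xor_ (complement x) (complement y) ≡ zipWith _xor_ x y
    xor-complement []      []      = refl
    xor-complement (a ∷ x) (b ∷ y) = cong₂ _∷_ (xor-annihilates-not a b) (xor-complement x y)

complement-involutive : ∀ {n} (x : Vec Bool n) → complement (complement x) ≡ x
complement-involutive []      = refl
complement-involutive (a ∷ x) = cong₂ _∷_ (not-involutive a) (complement-involutive x)

hamming-complement-swap : ∀ {n} (x y : Vec Bool n) →
  hamming x (complement y) ≡ hamming (complement x) y
hamming-complement-swap x y = begin
  hamming x (complement y)                           ≡⟨ cong (λ z → hamming z (complement y)) (complement-involutive x) ⟨
  hamming (complement (complement x)) (complement y) ≡⟨ hamming-complement (complement x) y ⟩
  hamming (complement x) y                           ∎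
  where open ≡-Reasoning

-- A position where x and y differ carries a zero in x or in y.
hamming≤zeros : ∀ {n} (x y : Vec Bool n) → hamming x y ≤ ones (complement x) + ones (complement y)
hamming≤zeros x y =
  subst (_≤ ones (complement x) + ones (complement y)) (hamming-complement x y)
    (hamming≤ones (complement x) (complement y))

-- A quarter of a k-vector is outer (k ones) or inner (t ∸ k ones, i.e. k zeros).
-- Against a quarter of an s-vector of the same kind, the quarter contributes at
-- most k + s to the distance, and exactly k + s − 2p for any overlap p ≤ k, s.

inner-zeros : ∀ {t k} (x : Vec Bool t) → k ≤ t → ones x ≡ t ∸ k → ones (complement x) ≡ k
inner-zeros {t} x k≤t ones-x = trans (ones-complement x) (trans (cong (t ∸_) ones-x) (m∸[m∸n]≡n k≤t))

outer-zeros : ∀ {t k s} (x : Vec Bool t) → ones x ≡ k → k + s ≤ t → s ≤ ones (complement x)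
outer-zeros {t} {k} {s} x ones-x k+s≤t = begin
  s                   ≤⟨ m+n≤o⇒m≤o∸n s (subst (_≤ t) (+-comm k s) k+s≤t) ⟩
  t ∸ k               ≡⟨ cong (t ∸_) ones-x ⟨
  t ∸ ones x          ≡⟨ ones-complement x ⟨
  ones (complement x) ∎
  where open ≤-Reasoning

-- Sharing p of the s ones of y with x saves 2p positions of difference.
shared-overlap : ∀ {h k s p} → p ≤ s → h + p ≡ k + (s ∸ p) → h + 2 * p ≡ k + s
shared-overlap {h} {k} {s} {p} p≤s e = begin
  h + 2 * p         ≡⟨ regroup h p ⟩
  (h + p) + p       ≡⟨ cong (_+ p) e ⟩
  k + (s ∸ p) + p   ≡⟨ +-assoc k (s ∸ p) p ⟩
  k + (s ∸ p + p)   ≡⟨ cong (_+_ k) (m∸n+n≡m p≤s) ⟩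
  k + s             ∎
  where
    open ≡-Reasoning
    regroup : ∀ h p → h + 2 * p ≡ (h + p) + p
    regroup = solve-∀

outer-realize : ∀ {t k s p} (x : Vec Bool t) → ones x ≡ k → k + s ≤ t → p ≤ k → p ≤ s →
  Σ (Vec Bool t) λ y → ones y ≡ s × hamming x y + 2 * p ≡ k + s
outer-realize {s = s} {p} x ones-x k+s≤t p≤k p≤s
  with realize x {p} {s ∸ p} (subst (p ≤_) (sym ones-x) p≤k)
         (≤-trans (m∸n≤m s p) (outer-zeros x ones-x k+s≤t))
... | y , ones-y , dist =
  y , trans ones-y (m+[n∸m]≡n p≤s) , shared-overlap p≤s (trans dist (cong (_+ (s ∸ p)) ones-x))

-- The inner case is the outer case for the complemented vectors.
inner-realize : ∀ {t k s p} (x : Vec Bool t) → ones x ≡ t ∸ k → k + s ≤ t → p ≤ k → p ≤ s →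
  Σ (Vec Bool t) λ y → ones y ≡ t ∸ s × hamming x y + 2 * p ≡ k + s
inner-realize {t} {k} {p = p} x ones-x k+s≤t p≤k p≤s
  with outer-realize (complement x) (inner-zeros x (m+n≤o⇒m≤o k k+s≤t) ones-x) k+s≤t p≤k p≤s
... | y , ones-y , dist =
  complement y , trans (ones-complement y) (cong (t ∸_) ones-y) ,
  trans (cong (_+ 2 * p) (hamming-complement-swap x y)) dist

join : ∀ {t} (a b c d : Vec Bool t) → Vec Bool (Len t)
join a b c d = a ++ (b ++ (c ++ d))

join-quarters : ∀ t (v : Vec Bool (Len t)) → join (q1 t v) (q2 t v) (q3 t v) (q4 t v) ≡ v
join-quarters t v = begin
  q1 t v ++ (q2 t v ++ (q3 t v ++ q4 t v)) ≡⟨ cong (λ z → q1 t v ++ (q2 t v ++ z)) (take++drop≡id t _) ⟩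
  q1 t v ++ (q2 t v ++ drop t (drop t v))  ≡⟨ cong (q1 t v ++_) (take++drop≡id t _) ⟩
  q1 t v ++ drop t v                       ≡⟨ take++drop≡id t v ⟩
  v                                        ∎
  where open ≡-Reasoning

take-drop-++ : ∀ {a} {A : Set a} {m n} (x : Vec A m) (y : Vec A n) →
  take m (x ++ y) ≡ x × drop m (x ++ y) ≡ y
take-drop-++ {m = m} x y = ++-injective (take m (x ++ y)) x (take++drop≡id m (x ++ y))

quarters-join : ∀ t (a b c d : Vec Bool t) → let v = join a b c d in
  q1 t v ≡ a × q2 t v ≡ b × q3 t v ≡ c × q4 t v ≡ d
quarters-join t a b c d with take-drop-++ a (b ++ (c ++ d)) | take-drop-++ b (c ++ d) | take-drop-++ c d
... | take-a , drop-a | take-b , drop-b | take-c , drop-c =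
  take-a ,
  trans (cong (take t) drop-a) take-b ,
  trans (cong (λ z → take t (drop t z)) drop-a) (trans (cong (take t) drop-b) take-c) ,
  trans (cong (λ z → drop t (drop t z)) drop-a) (trans (cong (drop t) drop-b) drop-c)

hamming-join : ∀ t (v : Vec Bool (Len t)) (a b c d : Vec Bool t) →
  hamming v (join a b c d) ≡
    hamming (q1 t v) a + (hamming (q2 t v) b + (hamming (q3 t v) c + hamming (q4 t v) d))
hamming-join t v a b c d = begin
  hamming v (join a b c d)
    ≡⟨ cong (λ z → hamming z (join a b c d)) (join-quarters t v) ⟨
  hamming (join (q1 t v) (q2 t v) (q3 t v) (q4 t v)) (join a b c d)
    ≡⟨ hamming-++ (q1 t v) _ a _ ⟩
  hamming (q1 t v) a + hamming (q2 t v ++ (q3 t v ++ q4 t v)) (b ++ (c ++ d))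
    ≡⟨ cong (λ z → hamming (q1 t v) a + z) (hamming-++ (q2 t v) _ b _) ⟩
  hamming (q1 t v) a + (hamming (q2 t v) b + hamming (q3 t v ++ q4 t v) (c ++ d))
    ≡⟨ cong (λ z → hamming (q1 t v) a + (hamming (q2 t v) b + z)) (hamming-++ (q3 t v) _ c _) ⟩
  hamming (q1 t v) a + (hamming (q2 t v) b + (hamming (q3 t v) c + hamming (q4 t v) d))
    ∎
  where open ≡-Reasoning

hamming-bound : ∀ t k s (v w : Vec Bool (Len t)) → k ≤ t → s ≤ t →
  IsKVec t k v → IsKVec t s w → hamming v w ≤ 4 * (k + s)
hamming-bound t k s v w k≤t s≤t (v₁ , v₂ , v₃ , v₄) (w₁ , w₂ , w₃ , w₄) = begin
  hamming v w
    ≡⟨ cong (hamming v) (join-quarters t w) ⟨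
  hamming v (join (q1 t w) (q2 t w) (q3 t w) (q4 t w))
    ≡⟨ hamming-join t v (q1 t w) (q2 t w) (q3 t w) (q4 t w) ⟩
  hamming (q1 t v) (q1 t w) + (hamming (q2 t v) (q2 t w) + (hamming (q3 t v) (q3 t w) + hamming (q4 t v) (q4 t w)))
    ≤⟨ +-mono-≤ (outer-quarter (q1 t v) (q1 t w) v₁ w₁)
         (+-mono-≤ (inner-quarter (q2 t v) (q2 t w) v₂ w₂)
         (+-mono-≤ (inner-quarter (q3 t v) (q3 t w) v₃ w₃) (outer-quarter (q4 t v) (q4 t w) v₄ w₄))) ⟩
  Len (k + s)
    ≡⟨ Len≡4* (k + s) ⟩
  4 * (k + s)
    ∎
  where
    open ≤-Reasoning
    outer-quarter : ∀ (x y : Vec Bool t) → ones x ≡ k → ones y ≡ s → hamming x y ≤ k + s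
    outer-quarter x y ones-x ones-y = subst (hamming x y ≤_) (cong₂ _+_ ones-x ones-y) (hamming≤ones x y)
    inner-quarter : ∀ (x y : Vec Bool t) → ones x ≡ t ∸ k → ones y ≡ t ∸ s → hamming x y ≤ k + s
    inner-quarter x y ones-x ones-y =
      subst (hamming x y ≤_) (cong₂ _+_ (inner-zeros x k≤t ones-x) (inner-zeros y s≤t ones-y))
        (hamming≤zeros x y)

record Split4 (m P : ℕ) : Set where
  constructor split
  field
    p₁ p₂ p₃ p₄ : ℕ
    p₁≤m : p₁ ≤ m
    p₂≤m : p₂ ≤ m
    p₃≤m : p₃ ≤ m
    p₄≤m : p₄ ≤ m
    sum  : p₁ + (p₂ + (p₃ + p₄)) ≡ P

-- Greedy splitting: every P ≤ 4m splits into four parts bounded by m.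
split4 : ∀ m P → P ≤ 4 * m → Split4 m P
split4 m P P≤4m = record
  { p₁ = m ⊓ P ; p₂ = m ⊓ R₁ ; p₃ = m ⊓ R₂ ; p₄ = R₂ ∸ m
  ; p₁≤m = m⊓n≤m m P ; p₂≤m = m⊓n≤m m R₁ ; p₃≤m = m⊓n≤m m R₂
  ; p₄≤m = m≤n+o⇒m∸n≤o R₂ m (m≤n+o⇒m∸n≤o R₁ m (m≤n+o⇒m∸n≤o P m (subst (P ≤_) (sym (Len≡4* m)) P≤4m)))
  ; sum = begin
      m ⊓ P + (m ⊓ R₁ + (m ⊓ R₂ + (R₂ ∸ m))) ≡⟨ cong (λ z → m ⊓ P + (m ⊓ R₁ + z)) (m⊓n+n∸m≡n m R₂) ⟩
      m ⊓ P + (m ⊓ R₁ + R₂)                  ≡⟨ cong (λ z → m ⊓ P + z) (m⊓n+n∸m≡n m R₁) ⟩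
      m ⊓ P + R₁                             ≡⟨ m⊓n+n∸m≡n m P ⟩
      P                                      ∎
  }
  where
    open ≡-Reasoning
    R₁ R₂ : ℕ
    R₁ = P ∸ m
    R₂ = R₁ ∸ m

add-quarters : ∀ h₁ h₂ h₃ h₄ p₁ p₂ p₃ p₄ {c} →
  h₁ + 2 * p₁ ≡ c → h₂ + 2 * p₂ ≡ c → h₃ + 2 * p₃ ≡ c → h₄ + 2 * p₄ ≡ c →
  (h₁ + (h₂ + (h₃ + h₄))) + 2 * (p₁ + (p₂ + (p₃ + p₄))) ≡ 4 * c
add-quarters h₁ h₂ h₃ h₄ p₁ p₂ p₃ p₄ {c} e₁ e₂ e₃ e₄ = begin
  (h₁ + (h₂ + (h₃ + h₄))) + 2 * (p₁ + (p₂ + (p₃ + p₄)))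
    ≡⟨ regroup h₁ h₂ h₃ h₄ p₁ p₂ p₃ p₄ ⟩
  (h₁ + 2 * p₁) + ((h₂ + 2 * p₂) + ((h₃ + 2 * p₃) + (h₄ + 2 * p₄)))
    ≡⟨ cong₂ _+_ e₁ (cong₂ _+_ e₂ (cong₂ _+_ e₃ e₄)) ⟩
  Len c
    ≡⟨ Len≡4* c ⟩
  4 * c
    ∎
  where
    open ≡-Reasoning
    regroup : ∀ h₁ h₂ h₃ h₄ p₁ p₂ p₃ p₄ →
      (h₁ + (h₂ + (h₃ + h₄))) + 2 * (p₁ + (p₂ + (p₃ + p₄)))
        ≡ (h₁ + 2 * p₁) + ((h₂ + 2 * p₂) + ((h₃ + 2 * p₃) + (h₄ + 2 * p₄)))
    regroup = solve-∀

realize-kvec : ∀ t k s {P} (v : Vec Bool (Len t)) → IsKVec t k v → k + s ≤ t → Split4 (k ⊓ s) P →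
  Σ (Vec Bool (Len t)) λ w → IsKVec t s w × hamming v w + 2 * P ≡ 4 * (k + s)
realize-kvec t k s {P} v (v₁ , v₂ , v₃ , v₄) k+s≤t (split p₁ p₂ p₃ p₄ p₁≤m p₂≤m p₃≤m p₄≤m sum)
  with outer-realize (q1 t v) v₁ k+s≤t (≤k p₁≤m) (≤s p₁≤m)
     | inner-realize (q2 t v) v₂ k+s≤t (≤k p₂≤m) (≤s p₂≤m)
     | inner-realize (q3 t v) v₃ k+s≤t (≤k p₃≤m) (≤s p₃≤m)
     | outer-realize (q4 t v) v₄ k+s≤t (≤k p₄≤m) (≤s p₄≤m)
  where
    ≤k : ∀ {p} → p ≤ k ⊓ s → p ≤ k
    ≤k p≤m = ≤-trans p≤m (m⊓n≤m k s)
    ≤s : ∀ {p} → p ≤ k ⊓ s → p ≤ s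
    ≤s p≤m = ≤-trans p≤m (m⊓n≤n k s)
... | a , ones-a , dist-a | b , ones-b , dist-b | c , ones-c , dist-c | d , ones-d , dist-d
  with quarters-join t a b c d
... | qa , qb , qc , qd =
  join a b c d ,
  (trans (cong ones qa) ones-a , trans (cong ones qb) ones-b ,
   trans (cong ones qc) ones-c , trans (cong ones qd) ones-d) ,
  distance
  where
    open ≡-Reasoning
    distance : hamming v (join a b c d) + 2 * P ≡ 4 * (k + s)
    distance = begin
      hamming v (join a b c d) + 2 * P
        ≡⟨ cong₂ (λ h z → h + 2 * z) (hamming-join t v a b c d) (sym sum) ⟩
      (hamming (q1 t v) a + (hamming (q2 t v) b + (hamming (q3 t v) c + hamming (q4 t v) d)))
        + 2 * (p₁ + (p₂ + (p₃ + p₄)))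
        ≡⟨ add-quarters (hamming (q1 t v) a) (hamming (q2 t v) b) (hamming (q3 t v) c) (hamming (q4 t v) d)
                        p₁ p₂ p₃ p₄ dist-a dist-b dist-c dist-d ⟩
      4 * (k + s)
        ∎

overlap-budget : ∀ {t k s} → 2 * k ≤ t → 2 * s ≤ t → 2 * (k + s) ≤ t + 4 * (k ⊓ s)
overlap-budget {t} {k} {s} 2k≤t 2s≤t = begin
  2 * (k + s)                 ≤⟨ ⊓-glb (one-side k s 2s≤t)
                                   (subst (_≤ t + 4 * s) (cong (2 *_) (+-comm s k)) (one-side s k 2k≤t)) ⟩
  (t + 4 * k) ⊓ (t + 4 * s)   ≡⟨ +-distribˡ-⊓ t (4 * k) (4 * s) ⟨
  t + (4 * k) ⊓ (4 * s)       ≡⟨ cong (t +_) (*-distribˡ-⊓ 4 k s) ⟨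
  t + 4 * (k ⊓ s)             ∎
  where
    open ≤-Reasoning
    one-side : ∀ a b → 2 * b ≤ t → 2 * (a + b) ≤ t + 4 * a
    one-side a b 2b≤t = begin
      2 * (a + b)      ≡⟨ regroup a b ⟩
      2 * b + 2 * a    ≤⟨ +-monoˡ-≤ (2 * a) 2b≤t ⟩
      t + 2 * a        ≤⟨ +-monoʳ-≤ t (*-monoˡ-≤ a {2} {4} (s≤s (s≤s z≤n))) ⟩
      t + 4 * a        ∎
      where
        regroup : ∀ a b → 2 * (a + b) ≡ 2 * b + 2 * a
        regroup = solve-∀

halves-sum : ∀ {t k s} → 2 * k ≤ t → 2 * s ≤ t → k + s ≤ t
halves-sum {t} {k} {s} 2k≤t 2s≤t = *-cancelˡ-≤ 2 (begin
  2 * (k + s)    ≡⟨ *-distribˡ-+ 2 k s ⟩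
  2 * k + 2 * s  ≤⟨ +-mono-≤ 2k≤t 2s≤t ⟩
  t + t          ≡⟨ cong (_+_ t) (+-identityʳ t) ⟨
  2 * t          ∎)
  where open ≤-Reasoning

double-distance : ∀ {t d P c} → d + 2 * P ≡ 4 * c → t + P ≡ 2 * c → 2 * d ≡ Len t
double-distance {t} {d} {P} {c} dist t+P = +-cancelʳ-≡ (4 * P) (2 * d) (Len t) (begin
  2 * d + 4 * P    ≡⟨ regroup₁ d P ⟩
  2 * (d + 2 * P)  ≡⟨ cong (2 *_) dist ⟩
  2 * (4 * c)      ≡⟨ regroup₂ c ⟩
  4 * (2 * c)      ≡⟨ cong (4 *_) t+P ⟨
  4 * (t + P)      ≡⟨ regroup₃ t P ⟩
  Len t + 4 * P    ∎)
  where
    open ≡-Reasoning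
    regroup₁ : ∀ d P → 2 * d + 4 * P ≡ 2 * (d + 2 * P)
    regroup₁ = solve-∀
    regroup₂ : ∀ c → 2 * (4 * c) ≡ 4 * (2 * c)
    regroup₂ = solve-∀
    regroup₃ : ∀ t P → 4 * (t + P) ≡ t + (t + (t + t)) + 4 * P
    regroup₃ = solve-∀

double-half : ∀ {t k} → k ≤ t / 2 → 2 * k ≤ t
double-half {t} {k} k≤t/2 = begin
  2 * k        ≤⟨ *-monoʳ-≤ 2 k≤t/2 ⟩
  2 * (t / 2)  ≡⟨ *-comm 2 (t / 2) ⟩
  t / 2 * 2    ≤⟨ m/n*n≤m t 2 ⟩
  t            ∎
  where open ≤-Reasoning

ceil-least : ∀ {t c} → t ≤ 2 * c → ⌈ t /2⌉ ≤ c
ceil-least {t} {c} t≤2c = s≤s⁻¹ (m<n*o⇒m/o<n {t + 1} {suc c} {2} (s≤s (begin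
  t + 1        ≡⟨ +-comm t 1 ⟩
  suc t        ≤⟨ s≤s t≤2c ⟩
  suc (2 * c)  ≡⟨ cong suc (*-comm 2 c) ⟩
  suc (c * 2)  ∎)))
  where open ≤-Reasoning

ceil-double : ∀ t → t ≤ 2 * ⌈ t /2⌉
ceil-double t = +-cancelˡ-≤ 1 t (2 * ⌈ t /2⌉) (begin
  1 + t                    ≡⟨ +-comm 1 t ⟩
  t + 1                    ≡⟨ m≡m%n+[m/n]*n (t + 1) 2 ⟩
  (t + 1) % 2 + ⌈ t /2⌉ * 2 ≤⟨ +-monoˡ-≤ (⌈ t /2⌉ * 2) (s≤s⁻¹ (m%n<n (t + 1) 2)) ⟩
  1 + ⌈ t /2⌉ * 2           ≡⟨ cong (1 +_) (*-comm ⌈ t /2⌉ 2) ⟩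
  1 + 2 * ⌈ t /2⌉           ∎)
  where open ≤-Reasoning

ceil-condition : ∀ t k s → (⌈ t /2⌉ ∸ k ≤ s) ⇔ (t ≤ 2 * (k + s))
ceil-condition t k s = mk⇔ to from
  where
    open ≤-Reasoning
    to : ⌈ t /2⌉ ∸ k ≤ s → t ≤ 2 * (k + s)
    to h = begin
      t                      ≤⟨ ceil-double t ⟩
      2 * ⌈ t /2⌉            ≤⟨ *-monoʳ-≤ 2 (m≤n+m∸n ⌈ t /2⌉ k) ⟩
      2 * (k + (⌈ t /2⌉ ∸ k)) ≤⟨ *-monoʳ-≤ 2 (+-monoʳ-≤ k h) ⟩
      2 * (k + s)            ∎
    from : t ≤ 2 * (k + s) → ⌈ t /2⌉ ∸ k ≤ s
    from t≤2c = m≤n+o⇒m∸n≤o ⌈ t /2⌉ k (ceil-least t≤2c)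

orthogonal-necessary : ∀ t k s (v w : Vec Bool (Len t)) → k ≤ t → s ≤ t →
  IsKVec t k v → IsKVec t s w → Orthogonal v w → t ≤ 2 * (k + s)
orthogonal-necessary t k s v w k≤t s≤t kv sw orth = *-cancelˡ-≤ 4 (begin
  4 * t               ≡⟨ Len≡4* t ⟨
  Len t               ≡⟨ Equivalence.to (orthogonal⇔ v w) orth ⟨
  2 * hamming v w     ≤⟨ *-monoʳ-≤ 2 (hamming-bound t k s v w k≤t s≤t kv sw) ⟩
  2 * (4 * (k + s))   ≡⟨ swap-factors (k + s) ⟩
  4 * (2 * (k + s))   ∎)
  where
    open ≤-Reasoning
    swap-factors : ∀ c → 2 * (4 * c) ≡ 4 * (2 * c)
    swap-factors = solve-∀

-- (⇐) If 2k, 2s ≤ t ≤ 2(k + s), some s-vector is orthogonal to the k-vector v: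
-- realize the total overlap P = 2(k + s) − t, split over the quarters.
orthogonal-sufficient : ∀ t k s (v : Vec Bool (Len t)) → IsKVec t k v →
  2 * k ≤ t → 2 * s ≤ t → t ≤ 2 * (k + s) →
  Σ (Vec Bool (Len t)) λ w → IsKVec t s w × Orthogonal v w
orthogonal-sufficient t k s v kv 2k≤t 2s≤t t≤2c =
  orthogonal (realize-kvec t k s v kv (halves-sum {t} {k} {s} 2k≤t 2s≤t) (split4 (k ⊓ s) P P≤4m))
  where
    P : ℕ
    P = 2 * (k + s) ∸ t
    P≤4m : P ≤ 4 * (k ⊓ s)
    P≤4m = m≤n+o⇒m∸n≤o (2 * (k + s)) t (overlap-budget {t} {k} {s} 2k≤t 2s≤t)
    t+P : t + P ≡ 2 * (k + s)
    t+P = m+[n∸m]≡n t≤2c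
    orthogonal : Σ (Vec Bool (Len t)) (λ w → IsKVec t s w × hamming v w + 2 * P ≡ 4 * (k + s)) →
      Σ (Vec Bool (Len t)) λ w → IsKVec t s w × Orthogonal v w
    orthogonal (w , sw , dist) =
      w , sw , Equivalence.from (orthogonal⇔ v w) (double-distance {t} {hamming v w} {P} {k + s} dist t+P)

proposition6 : (t k : ℕ) → 1 ≤ t → k ≤ t / 2 → (v : Vec Bool (Len t)) → IsKVec t k v →
    (s : ℕ) → s ≤ t / 2 →
      (Σ (Vec Bool (Len t)) (λ w → IsKVec t s w × Orthogonal v w)) ⇔ ((⌈ t /2⌉ ∸ k ≤ s) × (s ≤ t / 2))
proposition6 t k _ k≤t/2 v kv s s≤t/2 = mk⇔ necessary sufficient
  where
    2k≤t : 2 * k ≤ t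
    2k≤t = double-half k≤t/2
    2s≤t : 2 * s ≤ t
    2s≤t = double-half s≤t/2
    necessary : Σ (Vec Bool (Len t)) (λ w → IsKVec t s w × Orthogonal v w) → (⌈ t /2⌉ ∸ k ≤ s) × (s ≤ t / 2)
    necessary (w , sw , orth) =
      Equivalence.from (ceil-condition t k s)
        (orthogonal-necessary t k s v w (≤-trans (m≤n*m k 2) 2k≤t) (≤-trans (m≤n*m s 2) 2s≤t) kv sw orth) ,
      s≤t/2
    sufficient : (⌈ t /2⌉ ∸ k ≤ s) × (s ≤ t / 2) → Σ (Vec Bool (Len t)) (λ w → IsKVec t s w × Orthogonal v w)
    sufficient (condition , _) =
      orthogonal-sufficient t k s v kv 2k≤t 2s≤t (Equivalence.to (ceil-condition t k s) condition)
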